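{- Let $\Sigma$ be a totally ordered alphabet, $w \ge 1$ an integer, $E \subseteq \Sigma^w$ any set of strings of length $w$, and $E' = E \cup \{\mathtt{\#}, \mathtt{\$}^w\}$, where $\mathtt{\#}$ and $\mathtt{\$}$ are special symbols not in $\Sigma$ that are lexicographically smaller than every symbol of $\Sigma$. Let $T[0..n-1]$ be a string over $\Sigma$. Let $D$ be the maximal set of strings $d$ such that: $d$ is a substring of $\mathtt{\#}\,T\,\mathtt{\$}^w$; exactly one proper prefix of $d$ is in $E'$; exactly one proper suffix of $d$ is in $E'$; and no other substring of $d$ is in $E'$. Let $S$ be the set of all suffixes of elements of $D$ that have length greater than $w$. Suppose $s, s' \in S$ and $s \prec s'$. Then $s x \prec s' x'$ for any strings $x, x' \in (\Sigma \cup \{\mathtt{\#}, \mathtt{\$}\})^*$.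
   Context: $\prec$ denotes strict lexicographic precedence on strings over $\Sigma \cup \{\mathtt{\#},\mathtt{\$}\}$ (with the symbol order above, a proper prefix preceding its extensions). $\mathtt{\$}^w$ denotes $w$ copies of $\mathtt{\$}$. -}

module Defs where

open import Level using (0ℓ)
open import Data.Nat using (ℕ; _<_)
open import Data.List using (List; []; _∷_; _++_; map; replicate; length)
open import Data.Vec using (Vec; toList)
open import Data.Product using (Σ; ∃; _×_; _,_)
open import Data.Sum using (_⊎_)
open import Data.Empty using (⊥)
open import Relation.Nullary using (¬_)
open import Relation.Binary using (Rel)
open import Relation.Binary.PropositionalEquality using (_≡_)
import Data.List.Relation.Binary.Lex.Strict as LexS

data Sym (A : Set) : Set where
  hash   : Sym A
  dollar : Sym A
  chr    : A → Sym A

data SymLt {A : Set} (_<A_ : Rel A 0ℓ) : Sym A → Sym A → Set where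
  hash<dollar : SymLt _<A_ hash dollar
  hash<chr    : ∀ {a} → SymLt _<A_ hash (chr a)
  dollar<chr  : ∀ {a} → SymLt _<A_ dollar (chr a)
  chr<chr     : ∀ {a b} → a <A b → SymLt _<A_ (chr a) (chr b)

Str : Set → Set
Str A = List (Sym A)

_≺[_]_ : {A : Set} → Str A → Rel A 0ℓ → Str A → Set
s ≺[ _<A_ ] t = LexS.Lex-< _≡_ (SymLt _<A_) s t

InE' : {A : Set} (w : ℕ) (E : Vec A w → Set) → Str A → Set
InE' {A} w E u =
  (Σ (Vec A w) λ e → E e × u ≡ map chr (toList e))
  ⊎ (u ≡ hash ∷ [] ⊎ u ≡ replicate w dollar)

text : {A : Set} (w : ℕ) → List A → Str A
text w T = hash ∷ (map chr T ++ replicate w dollar)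

Substring : {A : Set} → Str A → Str A → Set
Substring {A} d t = Σ (Str A) λ l → Σ (Str A) λ r → t ≡ l ++ d ++ r

ProperPrefix : {A : Set} → Str A → Str A → Set
ProperPrefix {A} p d = Σ (Str A) λ r → ¬ (r ≡ []) × d ≡ p ++ r

ProperSuffix : {A : Set} → Str A → Str A → Set
ProperSuffix {A} q d = Σ (Str A) λ l → ¬ (l ≡ []) × d ≡ l ++ q

-- d ∈ D : d is a substring of # T $^w; exactly one proper prefix p of d is
-- in E'; exactly one proper suffix q of d is in E'; and every other
-- occurrence of an element of E' inside d is excluded (i.e. every occurrence
-- of an element of E' in d is the prefix occurrence of p or the suffix
-- occurrence of q).
InD : {A : Set} (w : ℕ) (E : Vec A w → Set) (T : List A) → Str A → Set
InD {A} w E T d =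
  Substring d (text w T) ×
  Σ (Str A) λ p → Σ (Str A) λ q →
    (ProperPrefix p d × InE' w E p ×
       (∀ p' → ProperPrefix p' d → InE' w E p' → p' ≡ p)) ×
    (ProperSuffix q d × InE' w E q ×
       (∀ q' → ProperSuffix q' d → InE' w E q' → q' ≡ q)) ×
    (∀ l u r → d ≡ l ++ u ++ r → InE' w E u →
       (l ≡ [] × u ≡ p) ⊎ (r ≡ [] × u ≡ q))

InS : {A : Set} (w : ℕ) (E : Vec A w → Set) (T : List A) → Str A → Set
InS {A} w E T s =
  Σ (Str A) λ d → InD w E T d × (Σ (Str A) λ l → d ≡ l ++ s) × w < length s

-- If s ≺ s' is decided at a mismatching symbol, it survives any extension. Otherwise s is a
-- proper prefix of s'. As s is longer than w, the E'-suffix q that ends the D-string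
-- containing s is a proper suffix of s, so q occurs in s' strictly inside: after a nonempty
-- part of s and before the nonempty rest of s'. That is an inner occurrence of an element of
-- E' in the D-string containing s', which the definition of D forbids.
module Submission where

open import Defs
open import Level using (Level; 0ℓ)
open import Data.Nat using (ℕ; _≥_; _<_; _≤_; s≤s)
open import Data.Nat.Properties using (≤-reflexive; ≤-trans; <⇒≱)
open import Data.List using (List; []; _∷_; _++_; length)
open import Data.List.Properties
  using (length-map; length-replicate; ++-assoc; ++-conicalʳ; ∷-injectiveʳ; length-++-≤ʳ)
open import Data.Vec using (Vec; toList)
open import Data.Vec.Properties using (length-toList)
open import Data.Product using (Σ; _×_; _,_)
open import Data.Sum using (_⊎_; inj₁; inj₂)
open import Data.Empty using (⊥-elim)
open import Relation.Nullary using (¬_)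
open import Relation.Binary using (Rel; IsStrictTotalOrder)
open import Relation.Binary.PropositionalEquality using (_≡_; _≢_; refl; sym; trans; cong)
open import Data.List.Relation.Binary.Lex.Strict using (Lex-<; base; halt; this; next)

module _ {B : Set} {ℓ : Level} {_<_ : Rel B ℓ} where

  Lex-<⇒properPrefix⊎++-invariant :
    ∀ {xs ys} → Lex-< _≡_ _<_ xs ys →
    (Σ (List B) λ zs → zs ≢ [] × ys ≡ xs ++ zs) ⊎
    (∀ us vs → Lex-< _≡_ _<_ (xs ++ us) (ys ++ vs))
  Lex-<⇒properPrefix⊎++-invariant (base ())
  Lex-<⇒properPrefix⊎++-invariant (halt {y} {ys}) = inj₁ (y ∷ ys , (λ ()) , refl)
  Lex-<⇒properPrefix⊎++-invariant (this x<y) = inj₂ λ _ _ → this x<y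
  Lex-<⇒properPrefix⊎++-invariant (next {x} refl xs<ys)
    with Lex-<⇒properPrefix⊎++-invariant xs<ys
  ... | inj₁ (zs , zs≢[] , ys≡xs++zs) = inj₁ (zs , zs≢[] , cong (x ∷_) ys≡xs++zs)
  ... | inj₂ xs++<ys++ = inj₂ λ us vs → next refl (xs++<ys++ us vs)

module _ {B : Set} where

  shorter-suffix⇒properSuffix :
    ∀ (l s l′ q : List B) → l ++ s ≡ l′ ++ q → length q < length s →
    Σ (List B) λ m → m ≢ [] × s ≡ m ++ q
  shorter-suffix⇒properSuffix l       s []       _ refl q<s = ⊥-elim (<⇒≱ q<s (length-++-≤ʳ s {l}))
  shorter-suffix⇒properSuffix []      _ (b ∷ l′) _ eq   _   = b ∷ l′ , (λ ()) , eq
  shorter-suffix⇒properSuffix (_ ∷ l) s (_ ∷ l′) q eq   q<s =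
    shorter-suffix⇒properSuffix l s l′ q (∷-injectiveʳ eq) q<s

module _ {A : Set} {w : ℕ} {E : Vec A w → Set} where

  InE'-length≤ : w ≥ 1 → ∀ {u} → InE' w E u → length u ≤ w
  InE'-length≤ _   (inj₁ (e , _ , refl)) = ≤-reflexive (trans (length-map chr (toList e)) (length-toList e))
  InE'-length≤ w≥1 (inj₂ (inj₁ refl))    = w≥1
  InE'-length≤ _   (inj₂ (inj₂ refl))    = ≤-reflexive (length-replicate w)

  module _ {T : List A} where

    InS⇒E'-properSuffix : w ≥ 1 → ∀ {s} → InS w E T s →
                           Σ (Str A) λ q → InE' w E q × ProperSuffix q s
    InS⇒E'-properSuffix w≥1 {s}
      (_ , (_ , _ , q , _ , ((l′ , _ , d≡l′++q) , q∈E' , _) , _) , (l , d≡l++s) , w<s) =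
      q , q∈E' , shorter-suffix⇒properSuffix l s l′ q (trans (sym d≡l++s) d≡l′++q)
                   (≤-trans (s≤s (InE'-length≤ w≥1 q∈E')) w<s)

    InS⇒no-inner-E' : ∀ {s} → InS w E T s → ∀ m u r → s ≡ m ++ u ++ r →
                      m ≢ [] → r ≢ [] → ¬ InE' w E u
    InS⇒no-inner-E' (d , (_ , _ , _ , _ , _ , occurrences) , (l , d≡l++s) , _)
                    m u r s≡m++u++r m≢[] r≢[] u∈E'
      with occurrences (l ++ m) u r d≡[l++m]++u++r u∈E'
      where
        d≡[l++m]++u++r : d ≡ (l ++ m) ++ u ++ r
        d≡[l++m]++u++r = trans d≡l++s (trans (cong (l ++_) s≡m++u++r) (sym (++-assoc l m (u ++ r))))
    ... | inj₁ (l++m≡[] , _) = m≢[] (++-conicalʳ l m l++m≡[])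
    ... | inj₂ (r≡[] , _)    = r≢[] r≡[]

lemma2 : {A : Set} (_<A_ : Rel A 0ℓ) → IsStrictTotalOrder _≡_ _<A_ →
    (w : ℕ) → w ≥ 1 → (E : Vec A w → Set) → (T : List A) →
    (s s' : Str A) → InS w E T s → InS w E T s' → s ≺[ _<A_ ] s' →
    (x x' : Str A) → (s ++ x) ≺[ _<A_ ] (s' ++ x')
lemma2 _<A_ _ w w≥1 E T s s' s∈S s'∈S s≺s' x x'
  with Lex-<⇒properPrefix⊎++-invariant s≺s'
... | inj₂ s++≺s'++ = s++≺s'++ x x'
... | inj₁ (y , y≢[] , s'≡s++y) with InS⇒E'-properSuffix w≥1 s∈S
... | q , q∈E' , m , m≢[] , s≡m++q =
  ⊥-elim (InS⇒no-inner-E' s'∈S m q y s'≡m++q++y m≢[] y≢[] q∈E')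
  where
    s'≡m++q++y : s' ≡ m ++ q ++ y
    s'≡m++q++y = trans s'≡s++y (trans (cong (_++ y) s≡m++q) (++-assoc m q y))
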